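{- For every $x\in\mathbb{N}$, $\beta(x)\leq\left\lfloor\frac{\gamma(x)}{2}\right\rfloor$.
   Context: $\{f_n\}$ is the Fibonacci sequence ($f_0=0$, $f_1=1$, $f_{n+2}=f_{n+1}+f_n$). For $x\in\mathbb{N}$, $\beta(x)=\min\{\sum_{i=2}^{l} b_i \mid x=\sum_{i=2}^{l} b_i f_i,\ (b_2,\ldots,b_l)\in\mathbb{N}^{l-1},\ l\geq 2\}$, and $\gamma(x)=\max\{l\in\mathbb{N}\mid f_l\leq x\}$ (so $\beta(0)=\gamma(0)=0$). -}

module Defs where

open import Data.Nat using (ℕ; zero; suc; _+_; _*_; _≤_; _/_)
open import Data.List using (List; []; _∷_)
open import Data.Nat.ListAction using (sum)
open import Data.Product using (Σ; _×_; _,_)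
open import Relation.Binary.PropositionalEquality using (_≡_)

fib : ℕ → ℕ
fib zero = 0
fib (suc zero) = 1
fib (suc (suc n)) = fib (suc n) + fib n

valueFrom : ℕ → List ℕ → ℕ
valueFrom k [] = 0
valueFrom k (b ∷ bs) = b * fib k + valueFrom (suc k) bs

-- a representation (b_2, ..., b_l) of x, l ≥ 2 (at least one coefficient)
record Rep (x : ℕ) : Set where
  constructor rep
  field
    b₂     : ℕ
    rest   : List ℕ
    valueOK : valueFrom 2 (b₂ ∷ rest) ≡ x

repSum : {x : ℕ} → Rep x → ℕ
repSum (rep b bs _) = sum (b ∷ bs)

IsBeta : ℕ → ℕ → Set
IsBeta x k = Σ (Rep x) (λ r → repSum r ≡ k) × ((r : Rep x) → k ≤ repSum r)

IsGamma : ℕ → ℕ → Set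
IsGamma x l = fib l ≤ x × ((m : ℕ) → fib m ≤ x → m ≤ l)

-- Every x < f(n+1) has a representation of weight at most ⌊n/2⌋, by induction on n:
-- if x ≥ f(n) then x - f(n) < f(n+1) - f(n) = f(n-1), so spending one unit of weight on
-- f(n) lowers the index by two. Maximality of γ(x) gives x < f(γ(x)+1).
module Submission where

open import Defs
open import Data.Nat using (ℕ; _≤_; _/_)
open import Data.Nat.Base using (zero; suc; _+_; _*_; _<_; z≤n; s≤s)
open import Data.Nat.Properties
open import Data.Nat.DivMod using (/-monoˡ-≤; m/n≡1+[m∸n]/n)
open import Data.Nat.ListAction using (sum)
open import Data.List using (List; []; _∷_)
open import Data.Product using (Σ; _,_)
open import Relation.Binary.PropositionalEquality
open import Relation.Nullary using (yes; no)
open import Algebra.Properties.CommutativeSemigroup +-commutativeSemigroup using (x∙yz≈y∙xz)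

incrementAt : ℕ → List ℕ → List ℕ
incrementAt zero    []       = 1 ∷ []
incrementAt zero    (b ∷ bs) = suc b ∷ bs
incrementAt (suc j) []       = 0 ∷ incrementAt j []
incrementAt (suc j) (b ∷ bs) = b ∷ incrementAt j bs

valueFrom-incrementAt : ∀ k j bs → valueFrom k (incrementAt j bs) ≡ fib (k + j) + valueFrom k bs
valueFrom-incrementAt k zero    bs rewrite +-identityʳ k with bs
... | []     = cong (_+ 0) (*-identityˡ (fib k))
... | b ∷ bs = +-assoc (fib k) (b * fib k) (valueFrom (suc k) bs)
valueFrom-incrementAt k (suc j) []       = begin
  valueFrom (suc k) (incrementAt j []) ≡⟨ valueFrom-incrementAt (suc k) j [] ⟩
  fib (suc k + j) + 0                  ≡⟨ cong (λ i → fib i + 0) (+-suc k j) ⟨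
  fib (k + suc j) + 0                  ∎
  where open ≡-Reasoning
valueFrom-incrementAt k (suc j) (b ∷ bs) = begin
  b * fib k + valueFrom (suc k) (incrementAt j bs)
    ≡⟨ cong (b * fib k +_) (valueFrom-incrementAt (suc k) j bs) ⟩
  b * fib k + (fib (suc k + j) + valueFrom (suc k) bs)
    ≡⟨ x∙yz≈y∙xz (b * fib k) (fib (suc k + j)) (valueFrom (suc k) bs) ⟩
  fib (suc k + j) + (b * fib k + valueFrom (suc k) bs)
    ≡⟨ cong (λ i → fib i + valueFrom k (b ∷ bs)) (+-suc k j) ⟨
  fib (k + suc j) + valueFrom k (b ∷ bs)
    ∎
  where open ≡-Reasoning

sum-incrementAt : ∀ j bs → sum (incrementAt j bs) ≡ suc (sum bs)
sum-incrementAt zero    []       = refl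
sum-incrementAt zero    (b ∷ bs) = refl
sum-incrementAt (suc j) []       = sum-incrementAt j []
sum-incrementAt (suc j) (b ∷ bs) = trans (cong (b +_) (sum-incrementAt j bs)) (+-suc b (sum bs))

emptyRep : Rep 0
emptyRep = rep 0 [] refl

addFibRep : ∀ j {d x} → fib (2 + j) + d ≡ x → Rep d → Rep x
addFibRep zero    eq (rep b bs ok) =
  rep (suc b) bs (trans (valueFrom-incrementAt 2 zero (b ∷ bs)) (trans (cong (fib 2 +_) ok) eq))
addFibRep (suc j) eq (rep b bs ok) =
  rep b (incrementAt j bs)
    (trans (valueFrom-incrementAt 2 (suc j) (b ∷ bs)) (trans (cong (fib (2 + suc j) +_) ok) eq))

repSum-addFibRep : ∀ j {d x} (eq : fib (2 + j) + d ≡ x) (r : Rep d) →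
                   repSum (addFibRep j eq r) ≡ suc (repSum r)
repSum-addFibRep zero    eq (rep b bs ok) = refl
repSum-addFibRep (suc j) eq (rep b bs ok) = sum-incrementAt (suc j) (b ∷ bs)

RepWithin : ℕ → ℕ → Set
RepWithin w x = Σ (Rep x) λ r → repSum r ≤ w

addFib-RepWithin : ∀ j {w d x} → fib (2 + j) + d ≡ x → RepWithin w d → RepWithin (suc w) x
addFib-RepWithin j {w} eq (r , r≤w) =
  addFibRep j eq r , subst (_≤ suc w) (sym (repSum-addFibRep j eq r)) (s≤s r≤w)

weaken-RepWithin : ∀ {v w x} → v ≤ w → RepWithin v x → RepWithin w x
weaken-RepWithin v≤w (r , r≤v) = r , ≤-trans r≤v v≤w

RepsBelowFib : ℕ → Set
RepsBelowFib n = ∀ x → x < fib (suc n) → RepWithin (n / 2) x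

repsBelowFib-step : ∀ n → RepsBelowFib n → RepsBelowFib (suc n) → RepsBelowFib (suc (suc n))
repsBelowFib-step n below below′ x x<f with fib (suc (suc n)) ≤? x
... | no  f≰x = weaken-RepWithin (/-monoˡ-≤ 2 (n≤1+n (suc n))) (below′ x (≰⇒> f≰x))
... | yes f≤x with d , f+d≡x ← m≤n⇒∃[o]m+o≡n f≤x =
  subst (λ w → RepWithin w x) (sym (m/n≡1+[m∸n]/n {suc (suc n)} {2} (s≤s (s≤s z≤n))))
    (addFib-RepWithin n f+d≡x (below d d<f))
  where
  d<f : d < fib (suc n)
  d<f = +-cancelˡ-< (fib (suc (suc n))) d (fib (suc n))
          (subst (_< fib (suc (suc (suc n)))) (sym f+d≡x) x<f)

repsBelowFib : ∀ n → RepsBelowFib n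
repsBelowFib zero          zero    _        = emptyRep , z≤n
repsBelowFib zero          (suc _) (s≤s ())
repsBelowFib (suc zero)    zero    _        = emptyRep , z≤n
repsBelowFib (suc zero)    (suc _) (s≤s ())
repsBelowFib (suc (suc n)) = repsBelowFib-step n (repsBelowFib n) (repsBelowFib (suc n))

IsGamma⇒<fib-suc : ∀ {x g} → IsGamma x g → x < fib (suc g)
IsGamma⇒<fib-suc (_ , maximal) = ≰⇒> λ f≤x → 1+n≰n (maximal (suc _) f≤x)

lemma22 : (x b g : ℕ) → IsBeta x b → IsGamma x g → b ≤ g / 2
lemma22 x b g (_ , minimal) gamma with r , r≤ ← repsBelowFib g x (IsGamma⇒<fib-suc gamma) =
  ≤-trans (minimal r) r≤
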